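{- Let $\hat{G}=(\hat{V},\hat{E})$ be a directed graph and $\hat{P}$ a simple path from $u$ to $v$ in $\hat{G}$. Consider an execution of $\mathrm{SeqSC1}(\hat{G})$, let $S$ be the shortcuts produced, and let $\{(G_1,P_1),\ldots,(G_k,P_k)\}$ be the set of path-relevant subproblems at depth $r$ in the flattened path-relevant tree. Then there is a $u$-to-$v$ path in $G_S=(\hat{V},\hat{E}\cup S)$ of length at most $2^r+2^{r-1}+\sum_{i=1}^k |P_i|$, where $|P_i|$ denotes the number of arcs of $P_i$.
   Context: Write $u\preceq v$ if there is a directed path from $u$ to $v$. The procedure $\mathrm{SeqSC1}(G)$ on $G=(V,E)$: if $V=\emptyset$ return $\emptyset$; else pick a pivot $x\in V$ uniformly at random, let $R^+=\{v:x\preceq v\}$, $R^-=\{u:u\preceq x\}$, create shortcuts $\{(x,v):v\in R^+\}\cup\{(u,x):u\in R^-\}$, set $V_B=R^+\cap R^-$, $V_S=R^+\setminus V_B$, $V_P=R^-\setminus V_B$, $V_R=V\setminus(V_B\cup V_S\cup V_P)$, and recurse on $G[V_S]$, $G[V_P]$, $G[V_R]$, returning the union of all shortcuts. Relations of a vertex $x$ to a path $P$: bridge (some path vertex reaches $x$ and $x$ reaches some path vertex), ancestor ($x$ reaches some path vertex but no path vertex reaches $x$), descendant (some path vertex reaches $x$ but $x$ reaches none), unrelated otherwise. Path-relevant subproblems are pairs $(G,P)$ consisting of a recursive call $\mathrm{SeqSC1}(G)$ and a nonempty subpath $P$ of $\hat{P}$ contained in $G$; the root is $(\hat{G},\hat{P})$.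 The children of $(G,P)$, determined by the pivot $x$ of the call $\mathrm{SeqSC1}(G)$, are: none if $x$ is a bridge of $P$ (a leaf; then shortcuts $(\mathrm{head}(P),x),(x,\mathrm{tail}(P))$ exist); $(G[V_R],P)$ if $x$ is unrelated to $P$; if $x$ is an ancestor, writing $P=P_1\circ P_2$ with $P_1$ the part of $P$ in $V_R$ and $P_2$ the part in $V_S$, the children are those of $(G[V_R],P_1)$, $(G[V_S],P_2)$ with nonempty path; if $x$ is a descendant, writing $P=P_1\circ P_2$ with $P_1$ the part in $V_P$ and $P_2$ the part in $V_R$, the children are those of $(G[V_P],P_1)$, $(G[V_R],P_2)$ with nonempty path. This defines the path-relevant subproblem tree; the flattened path-relevant tree is obtained by merging every node whose pivot is unrelated to its path with its unique child. Depth is measured from the root at depth $0$. -}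

module Defs where

open import Data.Nat using (ℕ; zero; suc; _+_; _∸_)
open import Data.Fin using (Fin)
open import Data.List using (List; []; _∷_; _++_; length)
open import Data.List.Relation.Unary.Any using (Any)
open import Data.List.Relation.Unary.All using (All)
open import Data.Product using (_×_)
open import Data.Sum using (_⊎_)
open import Data.Unit using (⊤)
open import Level using (Level)
open import Relation.Nullary using (¬_)
open import Relation.Binary.PropositionalEquality using (_≡_)

-- Walks given by their vertex list (nonempty); the number of arcs is length ∸ 1.
data Walk {ℓ} {A : Set} (E : A → A → Set ℓ) : A → A → List A → Set ℓ where
  [_] : (a : A) → Walk E a a (a ∷ [])
  _∷_ : ∀ {a b c vs} → E a b → Walk E b c vs → Walk E a c (a ∷ vs)

arcs : {A : Set} → List A → ℕ
arcs xs = length xs ∸ 1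

module _ {n : ℕ} (E : Fin n → Fin n → Set) where

  VSet : Set₁
  VSet = Fin n → Set

  Full : VSet
  Full _ = ⊤

  data Reach (V : VSet) : Fin n → Fin n → Set where
    here : ∀ {a} → V a → Reach V a a
    step : ∀ {a b c} → V a → E a b → Reach V b c → Reach V a c

  R⁺ R⁻ : VSet → Fin n → VSet
  R⁺ V x w = Reach V x w
  R⁻ V x w = Reach V w x

  -- V_S = R⁺ \ V_B, V_P = R⁻ \ V_B, V_R = V \ (R⁺ ∪ R⁻)
  VS VP VR : VSet → Fin n → VSet
  VS V x w = R⁺ V x w × ¬ R⁻ V x w
  VP V x w = R⁻ V x w × ¬ R⁺ V x w
  VR V x w = V w × ¬ R⁺ V x w × ¬ R⁻ V x w

  -- An execution of SeqSC1(G[V]), recording the pivot choices.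
  data Exec : VSet → Set₁ where
    empty : ∀ {V} → (∀ w → ¬ V w) → Exec V
    pivot : ∀ {V} (x : Fin n) → V x →
            Exec (VS V x) → Exec (VP V x) → Exec (VR V x) → Exec V

  data Shortcut : ∀ {V} → Exec V → Fin n → Fin n → Set₁ where
    outS : ∀ {V x vx eS eP eR w} → R⁺ V x w →
           Shortcut {V} (pivot x vx eS eP eR) x w
    inS  : ∀ {V x vx eS eP eR w} → R⁻ V x w →
           Shortcut {V} (pivot x vx eS eP eR) w x
    recS : ∀ {V x vx eS eP eR a b} → Shortcut eS a b →
           Shortcut {V} (pivot x vx eS eP eR) a b
    recP : ∀ {V x vx eS eP eR a b} → Shortcut eP a b →
           Shortcut {V} (pivot x vx eS eP eR) a b
    recR : ∀ {V x vx eS eP eR a b} → Shortcut eR a b →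
           Shortcut {V} (pivot x vx eS eP eR) a b

  FromP ToP : VSet → Fin n → List (Fin n) → Set
  FromP V x P = Any (λ p → Reach V p x) P
  ToP   V x P = Any (λ p → Reach V x p) P

  -- DSum e P r s : for the path-relevant subproblem (G[V], P) with execution e,
  -- the sum of |P_i| (number of arcs) over the nodes at depth r of the
  -- flattened path-relevant subtree rooted at (G[V], P) equals s.
  -- Unrelated pivots are merged with their unique child (same depth).
  mutual
    data DSum : ∀ {V} → Exec V → List (Fin n) → ℕ → ℕ → Set₁ where
      bridge0 : ∀ {V x vx eS eP eR P} →
        FromP V x P → ToP V x P →
        DSum {V} (pivot x vx eS eP eR) P 0 (arcs P)
      bridgeS : ∀ {V x vx eS eP eR P r} →
        FromP V x P → ToP V x P →
        DSum {V} (pivot x vx eS eP eR) P (suc r) 0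
      unrel : ∀ {V x vx eS eP eR P r s} →
        ¬ FromP V x P → ¬ ToP V x P → DSum eR P r s →
        DSum {V} (pivot x vx eS eP eR) P r s
      anc0 : ∀ {V x vx eS eP eR P} →
        ¬ FromP V x P → ToP V x P →
        DSum {V} (pivot x vx eS eP eR) P 0 (arcs P)
      ancS : ∀ {V x vx eS eP eR P r s₁ s₂} →
        ¬ FromP V x P → ToP V x P →
        (P₁ P₂ : List (Fin n)) → P ≡ P₁ ++ P₂ →
        All (VR V x) P₁ → All (VS V x) P₂ →
        Child eR P₁ r s₁ → Child eS P₂ r s₂ →
        DSum {V} (pivot x vx eS eP eR) P (suc r) (s₁ + s₂)
      desc0 : ∀ {V x vx eS eP eR P} →
        FromP V x P → ¬ ToP V x P →
        DSum {V} (pivot x vx eS eP eR) P 0 (arcs P)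
      descS : ∀ {V x vx eS eP eR P r s₁ s₂} →
        FromP V x P → ¬ ToP V x P →
        (P₁ P₂ : List (Fin n)) → P ≡ P₁ ++ P₂ →
        All (VP V x) P₁ → All (VR V x) P₂ →
        Child eP P₁ r s₁ → Child eR P₂ r s₂ →
        DSum {V} (pivot x vx eS eP eR) P (suc r) (s₁ + s₂)

    data Child : ∀ {V} → Exec V → List (Fin n) → ℕ → ℕ → Set₁ where
      none : ∀ {V} {e : Exec V} {r} → Child e [] r 0
      some : ∀ {V} {e : Exec V} {q qs r s} → DSum e (q ∷ qs) r s → Child e (q ∷ qs) r s

  WithShortcuts : Exec Full → Fin n → Fin n → Set₁
  WithShortcuts e a b = E a b ⊎ Shortcut e a b

-- A bridge pivot x at depth r ≥ 1 yields the
-- two-arc shortcut walk head → x → tail; an ancestor or descendant pivot splits the path into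
-- two consecutive pieces, one per child, whose shortcut walks are joined by the original arc
-- between the pieces; an unrelated pivot hands the whole path to its V_R-child at the same depth.
-- The invariant bounds twice the number of VERTICES of the walk by 2^(r+1) + 2^r + 2 s: vertex
-- counts add up exactly under joining, so the joining arc is paid for by the extra vertex, while
-- the budget 2^(r+1) + 2^r doubles from one level to the next.
module Submission where

open import Defs
open import Data.Nat using (ℕ; suc; _+_; _*_; _^_; _≤_)
open import Data.Fin using (Fin)
open import Data.List using (List)
open import Data.List.Relation.Unary.Unique.Propositional using (Unique)
open import Data.Product using (Σ; _×_)

open import Data.Nat using (zero)
open import Data.Nat.Properties
  using (≤-refl; ≤-trans; n≤1+n; m≤m+n; +-identityʳ; m∸n≤m; +-mono-≤; *-monoʳ-≤; *-distribˡ-+;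
         module ≤-Reasoning)
open import Data.Nat.Solver using (module +-*-Solver)
open import Data.List using ([]; _∷_; _++_; length)
open import Data.List.Properties using (length-++; ++-identityʳ)
open import Data.List.Relation.Unary.Any using (here; there)
open import Data.List.Relation.Unary.All using (All; []; _∷_; universal)
open import Data.Product using (_,_; ∃-syntax)
open import Data.Sum using (_⊎_; inj₁; inj₂; map₂)
open import Data.Unit using (tt)
open import Relation.Binary.PropositionalEquality using (_≡_; refl; sym; cong; subst)
open import Relation.Nullary using (¬_)

module _ {ℓ} {A : Set} {R : A → A → Set ℓ} where

  Walk-head : ∀ {a b x xs} → Walk R a b (x ∷ xs) → x ≡ a
  Walk-head [ _ ] = refl
  Walk-head (_ ∷ _) = refl

  length≡suc-arcs : ∀ {a b Q} → Walk R a b Q → length Q ≡ suc (arcs Q)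
  length≡suc-arcs [ _ ] = refl
  length≡suc-arcs (_ ∷ _) = refl

  Walk-join : ∀ {a c d b Q₁ Q₂} → Walk R a c Q₁ → R c d → Walk R d b Q₂ → Walk R a b (Q₁ ++ Q₂)
  Walk-join [ _ ] cd w₂ = cd ∷ w₂
  Walk-join (ac ∷ w₁) cd w₂ = ac ∷ Walk-join w₁ cd w₂

  Walk-split : ∀ q qs {y ys a b} → Walk R a b ((q ∷ qs) ++ (y ∷ ys)) →
    ∃[ c ] Walk R a c (q ∷ qs) × R c y × Walk R y b (y ∷ ys)
  Walk-split q [] (ay ∷ w) with Walk-head w
  ... | refl = _ , [ q ] , ay , w
  Walk-split q (q′ ∷ qs) (aq′ ∷ w) with Walk-split q′ qs w
  ... | c , w₁ , cy , w₂ with Walk-head w₁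
  ... | refl = c , aq′ ∷ w₁ , cy , w₂

Walk-map : ∀ {ℓ ℓ′} {A : Set} {R : A → A → Set ℓ} {R′ : A → A → Set ℓ′} →
  (∀ {a b} → R a b → R′ a b) → ∀ {a b Q} → Walk R a b Q → Walk R′ a b Q
Walk-map f [ a ] = [ a ]
Walk-map f (ab ∷ w) = f ab ∷ Walk-map f w

budget : ℕ → ℕ
budget r = 2 ^ suc r + 2 ^ r

budget-+ : ∀ r → budget r + budget r ≡ budget (suc r)
budget-+ r = solve 1 (λ x → (con 2 :* x :+ x) :+ (con 2 :* x :+ x)
                           := con 2 :* (con 2 :* x) :+ con 2 :* x) refl (2 ^ r)
  where open +-*-Solver

budget-mono : ∀ r → budget r ≤ budget (suc r)
budget-mono r = subst (budget r ≤_) (budget-+ r) (m≤m+n (budget r) (budget r))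

6≤budget-suc : ∀ r → 6 ≤ budget (suc r)
6≤budget-suc zero = ≤-refl
6≤budget-suc (suc r) = ≤-trans (6≤budget-suc r) (budget-mono (suc r))

module _ {n : ℕ} (E : Fin n → Fin n → Set) where

  Reach-trans : ∀ {V a b c} → Reach E V a b → Reach E V b c → Reach E V a c
  Reach-trans (here _) bc = bc
  Reach-trans (step va ab bc) cd = step va ab (Reach-trans bc cd)

  Walk⇒Reach : ∀ {V a b P} → Walk E a b P → All V P → Reach E V a b
  Walk⇒Reach [ _ ] (va ∷ []) = here va
  Walk⇒Reach (ab ∷ w) (va ∷ vs) = step va ab (Walk⇒Reach w vs)

  FromP⇒Reach : ∀ {V x a b P} → Walk E a b P → All V P → FromP E V x P → Reach E V a x
  FromP⇒Reach w vs (here px) with Walk-head w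
  ... | refl = px
  FromP⇒Reach (ab ∷ w) (va ∷ vs) (there px) = step va ab (FromP⇒Reach w vs px)

  ToP⇒Reach : ∀ {V x a b P} → Walk E a b P → All V P → ToP E V x P → Reach E V x b
  ToP⇒Reach w vs (here xp) with Walk-head w
  ... | refl = Reach-trans xp (Walk⇒Reach w vs)
  ToP⇒Reach (_ ∷ w) (_ ∷ vs) (there xp) = ToP⇒Reach w vs xp

  unrelated⇒VR : ∀ {V x P} → All V P → ¬ FromP E V x P → ¬ ToP E V x P → All (VR E V x) P
  unrelated⇒VR [] _ _ = []
  unrelated⇒VR (v ∷ vs) ¬from ¬to =
    (v , (λ xp → ¬to (here xp)) , (λ px → ¬from (here px)))
      ∷ unrelated⇒VR vs (λ px → ¬from (there px)) (λ xp → ¬to (there xp))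

  Augmented : ∀ {V} → Exec E V → Fin n → Fin n → Set₁
  Augmented e a b = E a b ⊎ Shortcut E e a b

  -- The bound is doubled so that budget 0 = 3 is an integer.
  record ShortcutWalk {V} (e : Exec E V) (a b : Fin n) (r s : ℕ) : Set₁ where
    constructor shortcutWalk
    field
      {vertices} : List (Fin n)
      walk       : Walk (Augmented e) a b vertices
      bound      : 2 * length vertices ≤ budget r + 2 * s

  module _ {V} {e : Exec E V} where

    original-walk : ∀ {a b P} → Walk E a b P → ShortcutWalk e a b 0 (arcs P)
    original-walk {P = P} w = shortcutWalk (Walk-map inj₁ w)
      (subst (λ k → 2 * k ≤ 3 + 2 * arcs P) (sym (length≡suc-arcs w))
        (subst (_≤ 3 + 2 * arcs P) (sym (*-distribˡ-+ 2 1 (arcs P))) (n≤1+n _)))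

    deepen : ∀ {a b r s} → ShortcutWalk e a b r s → ShortcutWalk e a b (suc r) s
    deepen {r = r} (shortcutWalk w bound) =
      shortcutWalk w (≤-trans bound (+-mono-≤ (budget-mono r) ≤-refl))

    join : ∀ {a c d b r s₁ s₂} → ShortcutWalk e a c r s₁ → E c d → ShortcutWalk e d b r s₂ →
      ShortcutWalk e a b (suc r) (s₁ + s₂)
    join {r = r} {s₁ = s₁} {s₂} (shortcutWalk {Q₁} w₁ bound₁) cd (shortcutWalk {Q₂} w₂ bound₂) =
      shortcutWalk (Walk-join w₁ (inj₁ cd) w₂) bound
      where
        open ≤-Reasoning
        open +-*-Solver
        bound : 2 * length (Q₁ ++ Q₂) ≤ budget (suc r) + 2 * (s₁ + s₂)
        bound = begin
          2 * length (Q₁ ++ Q₂)            ≡⟨ cong (2 *_) (length-++ Q₁) ⟩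
          2 * (length Q₁ + length Q₂)      ≡⟨ *-distribˡ-+ 2 (length Q₁) (length Q₂) ⟩
          2 * length Q₁ + 2 * length Q₂    ≤⟨ +-mono-≤ bound₁ bound₂ ⟩
          (budget r + 2 * s₁) + (budget r + 2 * s₂)
            ≡⟨ solve 3 (λ B x y → (B :+ con 2 :* x) :+ (B :+ con 2 :* y)
                                 := (B :+ B) :+ con 2 :* (x :+ y)) refl (budget r) s₁ s₂ ⟩
          (budget r + budget r) + 2 * (s₁ + s₂) ≡⟨ cong (_+ 2 * (s₁ + s₂)) (budget-+ r) ⟩
          budget (suc r) + 2 * (s₁ + s₂)   ∎

  embed : ∀ {V₁ V} {e₁ : Exec E V₁} {e : Exec E V} →
    (∀ {a b} → Shortcut E e₁ a b → Shortcut E e a b) →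
    ∀ {a b r s} → ShortcutWalk e₁ a b r s → ShortcutWalk e a b r s
  embed sub (shortcutWalk w bound) = shortcutWalk (Walk-map (map₂ sub) w) bound

  bridge-walk : ∀ {V x vx eS eP eR a b r} → Reach E V a x → Reach E V x b →
    ShortcutWalk (pivot {V = V} x vx eS eP eR) a b (suc r) 0
  bridge-walk {b = b} {r} ax xb =
    shortcutWalk (inj₂ (inS ax) ∷ inj₂ (outS xb) ∷ [ b ]) (≤-trans (6≤budget-suc r) (m≤m+n _ 0))

  mutual
    shortcut-walk : ∀ {V} {e : Exec E V} {a b P r s} →
      Walk E a b P → All V P → DSum E e P r s → ShortcutWalk e a b r s
    shortcut-walk w _ (bridge0 _ _) = original-walk w
    shortcut-walk w _ (anc0 _ _) = original-walk w
    shortcut-walk w _ (desc0 _ _) = original-walk w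
    shortcut-walk w vs (bridgeS from to) = bridge-walk (FromP⇒Reach w vs from) (ToP⇒Reach w vs to)
    shortcut-walk w vs (unrel ¬from ¬to d) = embed recR (shortcut-walk w (unrelated⇒VR vs ¬from ¬to) d)
    shortcut-walk w _ (ancS _ _ _ _ refl vs₁ vs₂ c₁ c₂) = sibling-walk recR recS w vs₁ vs₂ c₁ c₂
    shortcut-walk w _ (descS _ _ _ _ refl vs₁ vs₂ c₁ c₂) = sibling-walk recP recR w vs₁ vs₂ c₁ c₂

    sibling-walk : ∀ {V V₁ V₂} {e : Exec E V} {e₁ : Exec E V₁} {e₂ : Exec E V₂} →
      (∀ {a b} → Shortcut E e₁ a b → Shortcut E e a b) →
      (∀ {a b} → Shortcut E e₂ a b → Shortcut E e a b) →
      ∀ {a b P₁ P₂ r s₁ s₂} → Walk E a b (P₁ ++ P₂) → All V₁ P₁ → All V₂ P₂ →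
      Child E e₁ P₁ r s₁ → Child E e₂ P₂ r s₂ → ShortcutWalk e a b (suc r) (s₁ + s₂)
    sibling-walk sub₁ sub₂ w _ vs₂ none (some d₂) = deepen (embed sub₂ (shortcut-walk w vs₂ d₂))
    sibling-walk sub₁ sub₂ {a} {b} {P₁ = P₁} {r = r} {s₁} w vs₁ _ (some d₁) none =
      subst (ShortcutWalk _ a b (suc r)) (sym (+-identityʳ s₁))
        (deepen (embed sub₁ (shortcut-walk (subst (Walk E a b) (++-identityʳ P₁) w) vs₁ d₁)))
    sibling-walk sub₁ sub₂ {P₁ = q ∷ qs} w vs₁ vs₂ (some d₁) (some d₂) with Walk-split q qs w
    ... | _ , w₁ , cy , w₂ =
      join (embed sub₁ (shortcut-walk w₁ vs₁ d₁)) cy (embed sub₂ (shortcut-walk w₂ vs₂ d₂))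

lemma3 : {n : ℕ} (E : Fin n → Fin n → Set) (u v : Fin n) (P̂ : List (Fin n)) →
    Walk E u v P̂ → Unique P̂ →
    (e : Exec E (Full E)) (r s : ℕ) → DSum E e P̂ r s →
    Σ (List (Fin n)) λ Q → Walk (WithShortcuts E e) u v Q ×
    2 * arcs Q ≤ 2 ^ suc r + 2 ^ r + 2 * s
lemma3 E u v P̂ ŵ _ e r s d with shortcut-walk E ŵ (universal (λ _ → tt) P̂) d
... | shortcutWalk {Q} w bound = Q , w , ≤-trans (*-monoʳ-≤ 2 (m∸n≤m (length Q) 1)) bound
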